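{- Let $b,c_1,c_2$ be positive integers and let $\alpha/\beta$ be the right lobster $\mathcal{L}^{c_1,c_2}_b$, with $c=\min(c_1,c_2)$. Then the minimal elements of the poset $\mathrm{SET}(\alpha/\beta)$ are in bijection with binary words in the letters $B,C$ having $b$ occurrences of $B$ and $c$ occurrences of $C$. Therefore $\mathrm{SET}(\alpha/\beta)$ has $\binom{b+c}{b}$ minimal elements, one of which is $S^{\mathrm{col}}_{\alpha/\beta}$.
   Context: Compositions, diagrams (rows numbered from bottom, columns from left), and skew diagrams $\alpha/\beta$ for compositions $\beta\subseteq\alpha$ are as usual: $\alpha/\beta$ is the set of cells of the diagram of $\alpha$ (with $\alpha_i$ left-justified cells in row $i$) not in that of $\beta$. The right lobster $\mathcal{L}^{c_1,c_2}_b$ is $\alpha/\beta$ with $\alpha=(b+1+c_2,b+1,b+1+c_1)$, $\beta=(b+1,1,b+1)$: a top row (claw) of $c_1$ cells and a bottom row (claw) of $c_2$ cells, both starting at column $b+2$, and a middle row (body) of $b$ cells in columns $2,\ldots,b+1$. Let $n=b+c_1+c_2$. A standard extended tableau is a bijective filling of the cells with $1,\ldots,n$ strictly increasing left to right along rows and bottom to top along columns; $\mathrm{SET}(\alpha/\beta)$ denotes the set of these. For $1\le i\le n-1$, $\pi_i(T)=T$ if $i+1$ is in a strictly higher row than $i$, $\pi_i(T)=s_i(T)$ (swap $i$ and $i+1$) if $i+1$ is in a strictly lower row than $i$, and $\pi_i(T)=0$ if they are in the same row. Poset on $\mathrm{SET}(\alpha/\beta)$: $S\le T$ iff $T$ is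 obtained from $S$ by a finite sequence of operators $\pi_i$ with all intermediate results nonzero. $S^{\mathrm{col}}_{\alpha/\beta}$ is the tableau filled with $1,\ldots,n$ consecutively along columns from bottom to top, starting with the leftmost column and moving right. -}

module Defs where

open import Data.Nat using (ℕ; zero; suc; _+_; _<_; _≤_; _⊓_; _⊔_; _<ᵇ_; _≡ᵇ_)
open import Data.Nat.Combinatorics using (_C_)
open import Data.Bool using (Bool; true; false; if_then_else_)
open import Data.Product using (_×_; _,_; proj₁; proj₂; Σ; ∃)
open import Data.List using (List; []; _∷_; length; lookup; concatMap; map; upTo; filter; foldr)
open import Data.List.Relation.Binary.Permutation.Propositional using (_↭_)
open import Data.Maybe using (Maybe; just; nothing)
import Data.Maybe as Maybe
open import Data.Fin using (Fin; toℕ)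
open import Relation.Binary.PropositionalEquality using (_≡_)
open import Relation.Binary.Construct.Closure.ReflexiveTransitive using (Star)

-- Compositions are lists of natural numbers (row i of the diagram is the
-- i-th entry, rows numbered from the bottom starting at 1).
Composition : Set
Composition = List ℕ

-- A cell is (row , column), both 1-indexed; rows from the bottom,
-- columns from the left.
Cell : Set
Cell = ℕ × ℕ

row : Cell → ℕ
row = proj₁

col : Cell → ℕ
col = proj₂

-- i-th part (0-indexed), 0 beyond the length.
part : Composition → ℕ → ℕ
part []       _       = 0
part (x ∷ _)  zero    = x
part (_ ∷ xs) (suc i) = part xs i

rowCells : Composition → Composition → ℕ → List Cell
rowCells α β r =
  map (λ j → (suc r , suc j))
      (filter (λ j → Data.Nat._≤?_ (part β r) j) (upTo (part α r)))

cells : Composition → Composition → List Cell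
cells α β = concatMap (rowCells α β) (upTo (length α))

-- A filling T is represented by its inverse: T is the list whose k-th
-- element (k = 0,1,…) is the cell containing the entry k+1.
Filling : Set
Filling = List Cell

record IsSET (α β : Composition) (T : Filling) : Set where
  field
    bijective : T ↭ cells α β
    rowsIncr  : (i j : Fin (length T)) → toℕ i < toℕ j →
                row (lookup T i) ≡ row (lookup T j) →
                col (lookup T i) < col (lookup T j)
    colsIncr  : (i j : Fin (length T)) → toℕ i < toℕ j →
                col (lookup T i) ≡ col (lookup T j) →
                row (lookup T i) < row (lookup T j)

-- π at the k-th position (0-indexed): entries k+1 and k+2.
-- nothing represents the value 0.
πAux : ℕ → Filling → Maybe Filling
πAux zero (x ∷ y ∷ rest) =
  if row x <ᵇ row y then just (x ∷ y ∷ rest)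
  else if row y <ᵇ row x then just (y ∷ x ∷ rest)
  else nothing
πAux zero _ = nothing
πAux (suc k) [] = nothing
πAux (suc k) (x ∷ rest) = Maybe.map (x ∷_) (πAux k rest)

-- the operator π_i (1 ≤ i ≤ n-1); out of range indices give 0.
π : ℕ → Filling → Maybe Filling
π zero    _ = nothing
π (suc k) T = πAux k T

Step : Filling → Filling → Set
Step S T = ∃ λ i → π i S ≡ just T

_≼_ : Filling → Filling → Set
S ≼ T = Star Step S T

IsMinimal : Composition → Composition → Filling → Set
IsMinimal α β T = IsSET α β T × (∀ S → IsSET α β S → S ≼ T → S ≡ T)

colCells : Composition → Composition → ℕ → List Cell
colCells α β j = filter (λ x → Data.Nat._≟_ (col x) j) (cells α β)

Scol : Composition → Composition → Filling
Scol α β = concatMap (colCells α β) (map suc (upTo (foldr _⊔_ 0 α)))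

lobsterα : ℕ → ℕ → ℕ → Composition
lobsterα b c₁ c₂ = (b + 1 + c₂) ∷ (b + 1) ∷ (b + 1 + c₁) ∷ []

lobsterβ : ℕ → Composition
lobsterβ b = (b + 1) ∷ 1 ∷ (b + 1) ∷ []

data Letter : Set where
  𝐁 𝐂 : Letter

countB : List Letter → ℕ
countB [] = 0
countB (𝐁 ∷ w) = suc (countB w)
countB (𝐂 ∷ w) = countB w

countC : List Letter → ℕ
countC [] = 0
countC (𝐁 ∷ w) = countC w
countC (𝐂 ∷ w) = suc (countC w)

IsWord : ℕ → ℕ → List Letter → Set
IsWord b c w = (countB w ≡ b) × (countC w ≡ c)

-- A standard filling is minimal exactly when, whenever i + 1 lies higher than i, it lies
-- directly above i: otherwise swapping i and i + 1 gives a standard filling from which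
-- π_i leads back.  In the lobster the body lies strictly left of both claws, so the only
-- such climbs go from a bottom claw cell to the top claw cell above it.  Reading a minimal
-- tableau in the order of its entries therefore gives a word of body cells (B) and
-- vertical claw pairs (C) filling the c = min(c₁, c₂) common claw columns, while the
-- surplus cells of the longer claw are forced: surplus top cells right after the last pair,
-- surplus bottom cells at the very end.  Conversely each word with b letters B and c
-- letters C is read off a unique minimal tableau, and B^b C^c gives S^col.

module Submission where

open import Defs
open import Data.Bool using (true; false; T)
open import Data.Empty using (⊥; ⊥-elim)
open import Data.Fin using (Fin; toℕ) renaming (zero to fzero; suc to fsuc)
open import Data.List
  using (List; []; _∷_; _++_; [_]; length; lookup; map; replicate; filter; upTo; applyUpTo; concatMap; foldr)
open import Data.List.Membership.Propositional using (_∈_)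
open import Data.List.Membership.Propositional.Properties
  using (∈-lookup; ∈-++⁻; ∈-++⁺ˡ; ∈-++⁺ʳ; ∈-map⁺; ∈-map⁻)
open import Data.List.Properties
  using ( ++-assoc; ++-cancelˡ; ++-identityʳ; ∷-injective; ∷-injectiveʳ; filter-accept; filter-reject; filter-++
        ; length-map; length-++; concatMap-++; concatMap-cong; map-applyUpTo )
open import Data.List.Relation.Binary.Permutation.Propositional
  using (_↭_; prep; swap; ↭-trans; ↭-sym; ↭-refl; ↭-reflexive)
open import Data.List.Relation.Binary.Permutation.Propositional.Properties
  using (All-resp-↭; ++⁺ˡ; shift; drop-mid; ∈-resp-↭; ↭-empty-inv)
open import Data.List.Relation.Unary.All as All using (All; []; _∷_)
open import Data.List.Relation.Unary.AllPairs using (AllPairs; []; _∷_)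
open import Data.List.Relation.Unary.Any using (index; here; there)
open import Data.List.Relation.Unary.Any.Properties using (lookup-index)
open import Data.List.Relation.Unary.Linked as Linked using (Linked; []; [-]; _∷_)
open import Data.List.Relation.Unary.Unique.Propositional using (Unique)
import Data.List.Relation.Unary.Unique.Propositional.Properties as Unique
open import Data.Maybe using (just)
import Data.Maybe as Maybe
open import Data.Maybe.Properties using (just-injective)
open import Data.Nat
  using (ℕ; zero; suc; _+_; _∸_; _≤_; _<_; _⊓_; _⊔_; z≤n; s≤s; z<s; _≟_; _≤?_; _<ᵇ_)
open import Data.Nat.Combinatorics using (_C_; nCn≡1; nCk+nC[k+1]≡[n+1]C[k+1])
open import Data.Nat.Properties
open import Data.Product using (_×_; _,_; proj₁; proj₂; Σ; ∃; map₁; map₂)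
open import Data.Sum using (_⊎_; inj₁; inj₂; [_,_]′)
open import Data.Unit using (⊤; tt)
open import Function.Base using (_∘_)
open import Function.Bundles using (_⇔_; mk⇔)
open import Relation.Binary.Construct.Closure.ReflexiveTransitive using (ε; _◅_)
open import Relation.Binary.PropositionalEquality hiding ([_])
open import Relation.Nullary using (¬_; Dec; yes; no)

AllPairs⇒lookup : ∀ {A : Set} {R : A → A → Set} {xs} → AllPairs R xs →
                  (i j : Fin (length xs)) → toℕ i < toℕ j → R (lookup xs i) (lookup xs j)
AllPairs⇒lookup (Rx ∷ _)  fzero    (fsuc j) _         = All.lookup Rx (∈-lookup j)
AllPairs⇒lookup (_ ∷ Rxs) (fsuc i) (fsuc j) (s≤s i<j) = AllPairs⇒lookup Rxs i j i<j

lookup⇒AllPairs : ∀ {A : Set} {R : A → A → Set} xs →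
                  ((i j : Fin (length xs)) → toℕ i < toℕ j → R (lookup xs i) (lookup xs j)) →
                  AllPairs R xs
lookup⇒AllPairs []       _ = []
lookup⇒AllPairs {R = R} (x ∷ xs) R-lookup =
  All.tabulate (λ y∈xs → subst (R x) (sym (lookup-index y∈xs))
                                (R-lookup fzero (fsuc (index y∈xs)) (s≤s z≤n)))
  ∷ lookup⇒AllPairs xs (λ i j i<j → R-lookup (fsuc i) (fsuc j) (s≤s i<j))

AllPairs-swap : ∀ {A : Set} {R : A → A → Set} pre {x y zs} →
                AllPairs R (pre ++ x ∷ y ∷ zs) → R y x → AllPairs R (pre ++ y ∷ x ∷ zs)
AllPairs-swap []        ((_ ∷ Rxzs) ∷ Ryzs ∷ Rzs) Ryx = (Ryx ∷ Ryzs) ∷ Rxzs ∷ Rzs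
AllPairs-swap (w ∷ pre) (Rw ∷ Rs)                  Ryx =
  All-resp-↭ (++⁺ˡ pre (swap _ _ ↭-refl)) Rw ∷ AllPairs-swap pre Rs Ryx

AllPairs-suffix : ∀ {A : Set} {R : A → A → Set} pre {xs} → AllPairs R (pre ++ xs) → AllPairs R xs
AllPairs-suffix []        Rxs       = Rxs
AllPairs-suffix (_ ∷ pre) (_ ∷ Rxs) = AllPairs-suffix pre Rxs

Linked-suffix : ∀ {A : Set} {R : A → A → Set} pre {xs} → Linked R (pre ++ xs) → Linked R xs
Linked-suffix []        Rxs = Rxs
Linked-suffix (_ ∷ pre) Rxs = Linked-suffix pre (Linked.tail Rxs)

-- Standard fillings and minimality

Compatible : Cell → Cell → Set
Compatible x y = (row x ≡ row y → col x < col y) × (col x ≡ col y → row x < row y)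

higher⇒compatible : ∀ {x y} → row x < row y → Compatible x y
higher⇒compatible x<y = (λ x≡y → ⊥-elim (<-irrefl x≡y x<y)) , (λ _ → x<y)

left⇒compatible : ∀ {x y} → col x < col y → Compatible x y
left⇒compatible x<y = (λ _ → x<y) , (λ x≡y → ⊥-elim (<-irrefl x≡y x<y))

apart⇒compatible : ∀ {x y} → row x ≢ row y → col x ≢ col y → Compatible x y
apart⇒compatible rows≢ cols≢ = ⊥-elim ∘ rows≢ , ⊥-elim ∘ cols≢

Standard : Composition → Composition → Filling → Set
Standard α β T = T ↭ cells α β × AllPairs Compatible T

isSET⇒standard : ∀ {α β T} → IsSET α β T → Standard α β T
isSET⇒standard s = IsSET.bijective s ,
  lookup⇒AllPairs _ (λ i j i<j → IsSET.rowsIncr s i j i<j , IsSET.colsIncr s i j i<j)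

standard⇒isSET : ∀ {α β T} → Standard α β T → IsSET α β T
standard⇒isSET (T↭ , compatible) = record
  { bijective = T↭
  ; rowsIncr  = λ i j i<j → proj₁ (AllPairs⇒lookup compatible i j i<j)
  ; colsIncr  = λ i j i<j → proj₂ (AllPairs⇒lookup compatible i j i<j)
  }

data DescentSwap : Filling → Filling → Set where
  swap-at : ∀ pre {x y} zs → row y < row x → DescentSwap (pre ++ x ∷ y ∷ zs) (pre ++ y ∷ x ∷ zs)

πAux-inversion : ∀ k S U → πAux k S ≡ just U → U ≡ S ⊎ DescentSwap S U
πAux-inversion zero (x ∷ y ∷ zs) U eq with row x <ᵇ row y
... | true = inj₁ (sym (just-injective eq))
... | false with row y <ᵇ row x in y<ᵇx
...   | true with refl ← eq = inj₂ (swap-at [] zs (<ᵇ⇒< (row y) (row x) (subst T (sym y<ᵇx) tt)))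
...   | false with () ← eq
πAux-inversion (suc k) (z ∷ S) U eq with πAux k S in πS
... | just V with refl ← eq with πAux-inversion k S V πS
...   | inj₁ refl              = inj₁ refl
...   | inj₂ (swap-at pre zs lt) = inj₂ (swap-at (z ∷ pre) zs lt)

step-inversion : ∀ {S U} → Step S U → U ≡ S ⊎ DescentSwap S U
step-inversion (suc k , eq) = πAux-inversion k _ _ eq

π-climb : ∀ pre {x y} zs → row x < row y →
          π (suc (length pre)) (pre ++ y ∷ x ∷ zs) ≡ just (pre ++ x ∷ y ∷ zs)
π-climb [] {x} {y} zs x<y with row y <ᵇ row x in y<ᵇx
... | true  = ⊥-elim (<-asym x<y (<ᵇ⇒< (row y) (row x) (subst T (sym y<ᵇx) tt)))
... | false with row x <ᵇ row y in x<ᵇy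
...   | true  = refl
...   | false = ⊥-elim (subst T x<ᵇy (<⇒<ᵇ x<y))
π-climb (w ∷ pre) zs x<y = cong (Maybe.map (w ∷_)) (π-climb pre zs x<y)

standard-swap : ∀ {α β} pre {x y} zs → Compatible y x →
                Standard α β (pre ++ x ∷ y ∷ zs) → Standard α β (pre ++ y ∷ x ∷ zs)
standard-swap pre zs y⊑x (T↭ , compatible) =
  ↭-trans (++⁺ˡ pre (swap _ _ ↭-refl)) T↭ , AllPairs-swap pre compatible y⊑x

standard-step : ∀ {α β S U} → Step S U → Standard α β S → Standard α β U
standard-step {α} {β} st sS with step-inversion st
... | inj₁ refl                  = sS
... | inj₂ (swap-at pre {x} {y} zs y<x) =
  standard-swap {α} {β} pre {x} {y} zs (higher⇒compatible y<x) sS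

ClimbsInColumn : Cell → Cell → Set
ClimbsInColumn x y = row x < row y → col x ≡ col y

ClimbFree : Filling → Set
ClimbFree = Linked ClimbsInColumn

descentSwap-into-climbFree : ∀ {S U} → DescentSwap S U → AllPairs Compatible S → ClimbFree U → ⊥
descentSwap-into-climbFree (swap-at pre zs y<x) compatible climbFree
  with Linked-suffix pre climbFree | AllPairs-suffix pre compatible
... | y↗x ∷ _ | (x⊑y ∷ _) ∷ _ = <-asym y<x (proj₂ x⊑y (sym (y↗x y<x)))

steps-into-climbFree : ∀ {α β S T} → Standard α β S → ClimbFree T → S ≼ T → S ≡ T
steps-into-climbFree sS climbFree ε = refl
steps-into-climbFree {α} {β} sS climbFree (st ◅ sts)
  with steps-into-climbFree {α} {β} (standard-step {α} {β} st sS) climbFree sts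
... | refl with step-inversion st
...   | inj₁ refl = refl
...   | inj₂ sw   = ⊥-elim (descentSwap-into-climbFree sw (proj₂ sS) climbFree)

climbFree⇒minimal : ∀ {α β T} → Standard α β T → ClimbFree T → IsMinimal α β T
climbFree⇒minimal {α} {β} sT climbFree =
  standard⇒isSET sT , λ S S-SET S≼T → steps-into-climbFree {α} {β} (isSET⇒standard S-SET) climbFree S≼T

-- Otherwise swapping x and y gives a standard tableau strictly below T.
minimal-climbsInColumn : ∀ {α β} pre x y zs → IsMinimal α β (pre ++ x ∷ y ∷ zs) → ClimbsInColumn x y
minimal-climbsInColumn {α} {β} pre x y zs (T-SET , T-min) x<y with col x ≟ col y
... | yes x↗y = x↗y
... | no  x↛y = ⊥-elim (<-irrefl (cong row x≡y) x<y)
  where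
  y⊑x : Compatible y x
  y⊑x = apart⇒compatible (λ y≡x → <-irrefl (sym y≡x) x<y) (λ y≡x → x↛y (sym y≡x))
  S≡T : pre ++ y ∷ x ∷ zs ≡ pre ++ x ∷ y ∷ zs
  S≡T = T-min _ (standard⇒isSET (standard-swap {α} {β} pre zs y⊑x (isSET⇒standard T-SET)))
          ((suc (length pre) , π-climb pre zs x<y) ◅ ε)
  x≡y : x ≡ y
  x≡y = sym (proj₁ (∷-injective (++-cancelˡ pre _ _ S≡T)))

minimal⇒climbFree : ∀ {α β T} → IsMinimal α β T → ClimbFree T
minimal⇒climbFree {α} {β} = suffix {α} {β} []
  where
  suffix : ∀ {α β} pre {zs} → IsMinimal α β (pre ++ zs) → ClimbFree zs
  suffix pre {[]}          _   = []
  suffix pre {x ∷ []}      _   = [-]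
  suffix {α} {β} pre {x ∷ y ∷ zs} min =
    minimal-climbsInColumn pre x y zs min
    ∷ suffix (pre ++ [ x ]) (subst (IsMinimal α β) (sym (++-assoc pre [ x ] (y ∷ zs))) min)

-- Fillings of three row segments

data Row : Set where
  bottom middle top : Row

count : Row → List Row → ℕ
count r      []           = 0
count bottom (bottom ∷ w) = suc (count bottom w)
count middle (middle ∷ w) = suc (count middle w)
count top    (top ∷ w)    = suc (count top w)
count r      (_ ∷ w)      = count r w

-- A standard filling of three row segments is determined by the rows of its entries.
fill : ℕ → ℕ → ℕ → List Row → Filling
fill a p d []           = []
fill a p d (bottom ∷ w) = (1 , a) ∷ fill (suc a) p d w
fill a p d (middle ∷ w) = (2 , p) ∷ fill a (suc p) d w
fill a p d (top ∷ w)    = (3 , d) ∷ fill a p (suc d) w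

segment : ℕ → ℕ → ℕ → List Cell
segment r s zero    = []
segment r s (suc n) = (r , s) ∷ segment r (suc s) n

threeRows : ℕ → ℕ → ℕ → ℕ → ℕ → ℕ → List Cell
threeRows a p d n₁ n₂ n₃ = segment 1 a n₁ ++ segment 2 p n₂ ++ segment 3 d n₃

fill↭threeRows : ∀ a p d w → fill a p d w ↭ threeRows a p d (count bottom w) (count middle w) (count top w)
fill↭threeRows a p d []           = ↭-refl
fill↭threeRows a p d (bottom ∷ w) = prep _ (fill↭threeRows (suc a) p d w)
fill↭threeRows a p d (middle ∷ w) =
  ↭-trans (prep _ (fill↭threeRows a (suc p) d w)) (↭-sym (shift _ (segment 1 a (count bottom w)) _))
fill↭threeRows a p d (top ∷ w)    =
  ↭-trans (prep _ (fill↭threeRows a p (suc d) w))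
    (↭-trans (↭-sym (shift _ bottoms _)) (++⁺ˡ bottoms (↭-sym (shift _ (segment 2 p (count middle w)) _))))
  where bottoms = segment 1 a (count bottom w)

∈-segment : ∀ {y : Cell} r s n → y ∈ segment r s n → row y ≡ r × s ≤ col y × col y < s + n
∈-segment r s (suc n) (here refl) = refl , ≤-refl , m<m+n s z<s
∈-segment {y} r s (suc n) (there y∈) with ∈-segment r (suc s) n y∈
... | y-row , s<y , y<s+n = y-row , <⇒≤ s<y , subst (col y <_) (sym (+-suc s n)) y<s+n

∈-fill : ∀ {y} a p d w → y ∈ fill a p d w →
         (row y ≡ 1 × a ≤ col y × col y < a + count bottom w)
         ⊎ (row y ≡ 2 × p ≤ col y × col y < p + count middle w)
         ⊎ (row y ≡ 3 × d ≤ col y)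
∈-fill a p d w y∈ with ∈-++⁻ (segment 1 a _) (∈-resp-↭ (fill↭threeRows a p d w) y∈)
... | inj₁ y∈₁ = inj₁ (∈-segment 1 a _ y∈₁)
... | inj₂ y∈₂₃ with ∈-++⁻ (segment 2 p _) y∈₂₃
...   | inj₁ y∈₂ = inj₂ (inj₁ (∈-segment 2 p _ y∈₂))
...   | inj₂ y∈₃ with ∈-segment 3 d _ y∈₃
...     | y-row , d≤y , _ = inj₂ (inj₂ (y-row , d≤y))

rowOf : Cell → Row
rowOf (1 , _) = bottom
rowOf (2 , _) = middle
rowOf _       = top

rowWord-fill : ∀ a p d w → map rowOf (fill a p d w) ≡ w
rowWord-fill a p d []           = refl
rowWord-fill a p d (bottom ∷ w) = cong (bottom ∷_) (rowWord-fill (suc a) p d w)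
rowWord-fill a p d (middle ∷ w) = cong (middle ∷_) (rowWord-fill a (suc p) d w)
rowWord-fill a p d (top ∷ w)    = cong (top ∷_) (rowWord-fill a p (suc d) w)

fill-injective : ∀ a p d {w w′} → fill a p d w ≡ fill a p d w′ → w ≡ w′
fill-injective a p d {w} {w′} eq =
  trans (sym (rowWord-fill a p d w)) (trans (cong (map rowOf) eq) (rowWord-fill a p d w′))

segment-head : ∀ {x T L s} → x ∷ T ↭ L → (row x , s) ∈ L → s ≤ col x → All (Compatible x) T →
               col x ≡ s
segment-head {x} T↭ s∈L s≤x x⊑T with m≤n⇒m<n∨m≡n s≤x
... | inj₂ s≡x = sym s≡x
... | inj₁ s<x with ∈-resp-↭ (↭-sym T↭) s∈L
...   | here  s≡x = ⊥-elim (<-irrefl (cong col s≡x) s<x)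
...   | there s∈T = ⊥-elim (<-asym s<x (proj₁ (All.lookup x⊑T s∈T) refl))

peel-segment : ∀ {x T r s n} A B → x ∷ T ↭ A ++ segment r s n ++ B → x ∈ segment r s n →
               All (Compatible x) T → ∃ λ m → n ≡ suc m × x ≡ (r , s) × T ↭ A ++ segment r (suc s) m ++ B
peel-segment {x = x} {r = r} {s} {suc m} A B T↭ x∈ x⊑T with ∈-segment r s (suc m) x∈
... | refl , s≤x , _ with segment-head T↭ (∈-++⁺ʳ A (here refl)) s≤x x⊑T
...   | refl = m , refl , refl , drop-mid [] A T↭

threeRows-empty : ∀ {a p d} n₁ n₂ n₃ → threeRows a p d n₁ n₂ n₃ ≡ [] →
                  n₁ ≡ 0 × n₂ ≡ 0 × n₃ ≡ 0
threeRows-empty zero    zero    zero    _  = refl , refl , refl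
threeRows-empty (suc _) _       _       ()
threeRows-empty zero    (suc _) _       ()
threeRows-empty zero    zero    (suc _) ()

threeRows-top-last : ∀ a p d n₁ n₂ n₃ →
                     threeRows a p d n₁ n₂ n₃ ≡ (segment 1 a n₁ ++ segment 2 p n₂) ++ segment 3 d n₃ ++ []
threeRows-top-last a p d n₁ n₂ n₃ =
  trans (sym (++-assoc (segment 1 a n₁) (segment 2 p n₂) (segment 3 d n₃)))
        (cong ((segment 1 a n₁ ++ segment 2 p n₂) ++_) (sym (++-identityʳ (segment 3 d n₃))))

threeRows⇒fill : ∀ {T} a p d n₁ n₂ n₃ → T ↭ threeRows a p d n₁ n₂ n₃ → AllPairs Compatible T →
  ∃ λ w → T ≡ fill a p d w × count bottom w ≡ n₁ × count middle w ≡ n₂ × count top w ≡ n₃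
threeRows⇒fill {[]} a p d n₁ n₂ n₃ T↭ _ with threeRows-empty n₁ n₂ n₃ (↭-empty-inv (↭-sym T↭))
... | refl , refl , refl = [] , refl , refl , refl , refl
threeRows⇒fill {x ∷ T} a p d n₁ n₂ n₃ T↭ (x⊑T ∷ compatible)
  with ∈-++⁻ (segment 1 a n₁) (∈-resp-↭ T↭ (here refl))
... | inj₁ x∈₁ with peel-segment [] _ T↭ x∈₁ x⊑T
...   | m , refl , refl , T↭′ with threeRows⇒fill (suc a) p d m n₂ n₃ T↭′ compatible
...     | w , refl , c₁ , c₂ , c₃ = bottom ∷ w , refl , cong suc c₁ , c₂ , c₃
threeRows⇒fill {x ∷ T} a p d n₁ n₂ n₃ T↭ (x⊑T ∷ compatible)
    | inj₂ x∈₂₃ with ∈-++⁻ (segment 2 p n₂) x∈₂₃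
...   | inj₁ x∈₂ with peel-segment (segment 1 a n₁) _ T↭ x∈₂ x⊑T
...     | m , refl , refl , T↭′ with threeRows⇒fill a (suc p) d n₁ m n₃ T↭′ compatible
...       | w , refl , c₁ , c₂ , c₃ = middle ∷ w , refl , c₁ , cong suc c₂ , c₃
threeRows⇒fill {x ∷ T} a p d n₁ n₂ n₃ T↭ (x⊑T ∷ compatible)
    | inj₂ x∈₂₃ | inj₂ x∈₃
  with peel-segment (segment 1 a n₁ ++ segment 2 p n₂) []
         (↭-trans T↭ (↭-reflexive (threeRows-top-last a p d n₁ n₂ n₃))) x∈₃ x⊑T
...     | m , refl , refl , T↭′
  with threeRows⇒fill a p (suc d) n₁ n₂ m
         (↭-trans T↭′ (↭-reflexive (sym (threeRows-top-last a p (suc d) n₁ n₂ m)))) compatible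
...       | w , refl , c₁ , c₂ , c₃ = top ∷ w , refl , c₁ , c₂ , cong suc c₃

-- Each top entry either has the bottom entry of its column already placed (d < a)
-- or is followed by no bottom entries at all.
TopsSupported : ℕ → ℕ → List Row → Set
TopsSupported a d []           = ⊤
TopsSupported a d (bottom ∷ w) = TopsSupported (suc a) d w
TopsSupported a d (middle ∷ w) = TopsSupported a d w
TopsSupported a d (top ∷ w)    = (d < a ⊎ count bottom w ≡ 0) × TopsSupported a (suc d) w

fill-compatible : ∀ a p d w → p + count middle w ≤ a → p + count middle w ≤ d → TopsSupported a d w →
                  AllPairs Compatible (fill a p d w)
fill-compatible a p d []           _   _   _ = []
fill-compatible a p d (bottom ∷ w) p≤a p≤d supported =
  All.tabulate first ∷ fill-compatible (suc a) p d w (m≤n⇒m≤1+n p≤a) p≤d supported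
  where
  first : ∀ {y} → y ∈ fill (suc a) p d w → Compatible (1 , a) y
  first y∈ with ∈-fill (suc a) p d w y∈
  ... | inj₁ (_ , a<y , _)     = left⇒compatible a<y
  ... | inj₂ (inj₁ (refl , _)) = higher⇒compatible (s≤s z<s)
  ... | inj₂ (inj₂ (refl , _)) = higher⇒compatible (s≤s z<s)
fill-compatible a p d (middle ∷ w) p≤a p≤d supported =
  All.tabulate first
  ∷ fill-compatible a (suc p) d w (subst (_≤ a) (+-suc p _) p≤a) (subst (_≤ d) (+-suc p _) p≤d) supported
  where
  first : ∀ {y} → y ∈ fill a (suc p) d w → Compatible (2 , p) y
  first y∈ with ∈-fill a (suc p) d w y∈
  ... | inj₁ (refl , a≤y , _)      =
    apart⇒compatible (λ ()) (λ p≡y → <-irrefl p≡y (<-≤-trans (<-≤-trans (m<m+n p z<s) p≤a) a≤y))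
  ... | inj₂ (inj₁ (_ , p<y , _)) = left⇒compatible p<y
  ... | inj₂ (inj₂ (refl , _))    = higher⇒compatible (s≤s (s≤s z<s))
fill-compatible a p d (top ∷ w)    p≤a p≤d (supported , rest) =
  All.tabulate first ∷ fill-compatible a p (suc d) w p≤a (m≤n⇒m≤1+n p≤d) rest
  where
  first : ∀ {y} → y ∈ fill a p (suc d) w → Compatible (3 , d) y
  first {y} y∈ with ∈-fill a p (suc d) w y∈
  ... | inj₁ (refl , a≤y , y<a+n)  = apart⇒compatible (λ ()) (λ d≡y → unsupported d≡y supported)
    where
    unsupported : d ≡ col y → d < a ⊎ count bottom w ≡ 0 → ⊥
    unsupported d≡y (inj₁ d<a)  = <-irrefl d≡y (<-≤-trans d<a a≤y)
    unsupported _   (inj₂ none) =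
      <-irrefl refl (<-≤-trans (subst (col y <_) (trans (cong (a +_) none) (+-identityʳ a)) y<a+n) a≤y)
  ... | inj₂ (inj₁ (refl , _ , y<p+n)) =
    apart⇒compatible (λ ()) (λ d≡y → <-irrefl (sym d≡y) (<-≤-trans y<p+n p≤d))
  ... | inj₂ (inj₂ (_ , d<y))           = left⇒compatible d<y

-- Words in 𝐁 and 𝐂 as row words

whenZero : ℕ → ℕ → ℕ
whenZero zero    e = e
whenZero (suc _) e = 0

-- 𝐁 is a body cell, 𝐂 a bottom claw cell immediately followed by the top claw cell
-- above it; the e₃ surplus top cells follow the last 𝐂, the e₁ surplus bottom cells
-- come last.
encode : ℕ → ℕ → List Letter → List Row
encode e₁ e₃ []      = replicate e₁ bottom
encode e₁ e₃ (𝐁 ∷ w) = middle ∷ encode e₁ e₃ w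
encode e₁ e₃ (𝐂 ∷ w) = bottom ∷ top ∷ replicate (whenZero (countC w) e₃) top ++ encode e₁ e₃ w

decode : List Row → List Letter
decode []                 = []
decode (middle ∷ w)       = 𝐁 ∷ decode w
decode (top ∷ w)          = decode w
decode (bottom ∷ top ∷ w) = 𝐂 ∷ decode w
decode (bottom ∷ w)       = decode w

count-bottoms : ∀ k → count bottom (replicate k bottom) ≡ k
count-bottoms zero    = refl
count-bottoms (suc k) = cong suc (count-bottoms k)

count-middle-bottoms : ∀ k → count middle (replicate k bottom) ≡ 0
count-middle-bottoms zero    = refl
count-middle-bottoms (suc k) = count-middle-bottoms k

count-top-bottoms : ∀ k → count top (replicate k bottom) ≡ 0
count-top-bottoms zero    = refl
count-top-bottoms (suc k) = count-top-bottoms k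

count-bottom-tops : ∀ k w → count bottom (replicate k top ++ w) ≡ count bottom w
count-bottom-tops zero    w = refl
count-bottom-tops (suc k) w = count-bottom-tops k w

count-middle-tops : ∀ k w → count middle (replicate k top ++ w) ≡ count middle w
count-middle-tops zero    w = refl
count-middle-tops (suc k) w = count-middle-tops k w

count-top-tops : ∀ k w → count top (replicate k top ++ w) ≡ k + count top w
count-top-tops zero    w = refl
count-top-tops (suc k) w = cong suc (count-top-tops k w)

count-bottom-middles : ∀ k → count bottom (replicate k middle) ≡ 0
count-bottom-middles zero    = refl
count-bottom-middles (suc k) = count-bottom-middles k

count-top-middles : ∀ k → count top (replicate k middle) ≡ 0
count-top-middles zero    = refl
count-top-middles (suc k) = count-top-middles k

module _ (e₁ e₃ : ℕ) where

  count-bottom-encode : ∀ w → count bottom (encode e₁ e₃ w) ≡ countC w + e₁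
  count-bottom-encode []      = count-bottoms e₁
  count-bottom-encode (𝐁 ∷ w) = count-bottom-encode w
  count-bottom-encode (𝐂 ∷ w) =
    cong suc (trans (count-bottom-tops (whenZero (countC w) e₃) _) (count-bottom-encode w))

  count-middle-encode : ∀ w → count middle (encode e₁ e₃ w) ≡ countB w
  count-middle-encode []      = count-middle-bottoms e₁
  count-middle-encode (𝐁 ∷ w) = cong suc (count-middle-encode w)
  count-middle-encode (𝐂 ∷ w) = trans (count-middle-tops (whenZero (countC w) e₃) _) (count-middle-encode w)

  count-top-encode : ∀ w → count top (encode e₁ e₃ w) + whenZero (countC w) e₃ ≡ countC w + e₃
  count-top-encode []      = cong (_+ e₃) (count-top-bottoms e₁)
  count-top-encode (𝐁 ∷ w) = count-top-encode w
  count-top-encode (𝐂 ∷ w) = cong suc (begin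
    count top (replicate k top ++ encode e₁ e₃ w) + 0 ≡⟨ +-identityʳ _ ⟩
    count top (replicate k top ++ encode e₁ e₃ w)     ≡⟨ count-top-tops k _ ⟩
    k + count top (encode e₁ e₃ w)                    ≡⟨ +-comm k _ ⟩
    count top (encode e₁ e₃ w) + k                    ≡⟨ count-top-encode w ⟩
    countC w + e₃                                     ∎)
    where
    open ≡-Reasoning
    k = whenZero (countC w) e₃

decode-bottoms : ∀ k → decode (replicate k bottom) ≡ []
decode-bottoms zero          = refl
decode-bottoms (suc zero)    = refl
decode-bottoms (suc (suc k)) = decode-bottoms (suc k)

decode-tops : ∀ k w → decode (replicate k top ++ w) ≡ decode w
decode-tops zero    w = refl
decode-tops (suc k) w = decode-tops k w

decode-encode : ∀ e₁ e₃ w → decode (encode e₁ e₃ w) ≡ w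
decode-encode e₁ e₃ []      = decode-bottoms e₁
decode-encode e₁ e₃ (𝐁 ∷ w) = cong (𝐁 ∷_) (decode-encode e₁ e₃ w)
decode-encode e₁ e₃ (𝐂 ∷ w) =
  cong (𝐂 ∷_) (trans (decode-tops (whenZero (countC w) e₃) _) (decode-encode e₁ e₃ w))

topsSupported-bottoms : ∀ k a d → TopsSupported a d (replicate k bottom)
topsSupported-bottoms zero    a d = tt
topsSupported-bottoms (suc k) a d = topsSupported-bottoms k (suc a) d

topsSupported-noBottoms : ∀ w a d → count bottom w ≡ 0 → TopsSupported a d w
topsSupported-noBottoms []           a d _    = tt
topsSupported-noBottoms (middle ∷ w) a d none = topsSupported-noBottoms w a d none
topsSupported-noBottoms (top ∷ w)    a d none = inj₂ none , topsSupported-noBottoms w a (suc d) none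

encode-topsSupported : ∀ e₁ e₃ → e₁ ≡ 0 ⊎ e₃ ≡ 0 → ∀ w q → TopsSupported q q (encode e₁ e₃ w)
encode-topsSupported e₁ e₃ _ []      q = topsSupported-bottoms e₁ q q
encode-topsSupported e₁ e₃ e (𝐁 ∷ w) q = encode-topsSupported e₁ e₃ e w q
encode-topsSupported e₁ e₃ e (𝐂 ∷ w) q with countC w in noC
... | suc _ = inj₁ ≤-refl , encode-topsSupported e₁ e₃ e w (suc q)
encode-topsSupported e₁ _  (inj₂ refl) (𝐂 ∷ w) q | zero =
  inj₁ ≤-refl , encode-topsSupported e₁ 0 (inj₂ refl) w (suc q)
encode-topsSupported _  e₃ (inj₁ refl) (𝐂 ∷ w) q | zero = inj₁ ≤-refl ,
  topsSupported-noBottoms (replicate e₃ top ++ encode 0 e₃ w) (suc q) (suc q)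
    (trans (count-bottom-tops e₃ _) (trans (count-bottom-encode 0 e₃ w) (trans (+-identityʳ _) noC)))

notHigher⇒climbsInColumn : ∀ {x y} → row y ≤ row x → ClimbsInColumn x y
notHigher⇒climbsInColumn y≤x x<y = ⊥-elim (<⇒≱ x<y y≤x)

climbFree-bottoms : ∀ {y} k a p d → 1 ≤ row y → ClimbFree (y ∷ fill a p d (replicate k bottom))
climbFree-bottoms zero    a p d _   = [-]
climbFree-bottoms (suc k) a p d 1≤y = notHigher⇒climbsInColumn 1≤y ∷ climbFree-bottoms k (suc a) p d ≤-refl

module _ (e₁ e₃ : ℕ) where

  climbFree-noC : ∀ {y} w a p d → countC w ≡ 0 → 2 ≤ row y → ClimbFree (y ∷ fill a p d (encode e₁ e₃ w))
  climbFree-noC []      a p d _    2≤y = climbFree-bottoms e₁ a p d (<⇒≤ 2≤y)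
  climbFree-noC (𝐁 ∷ w) a p d none 2≤y =
    notHigher⇒climbsInColumn 2≤y ∷ climbFree-noC w a (suc p) d none ≤-refl

  climbFree-tops : ∀ {y} k w a p d → countC w ≡ 0 → 3 ≤ row y →
                   ClimbFree (y ∷ fill a p d (replicate k top ++ encode e₁ e₃ w))
  climbFree-tops zero    w a p d none 3≤y = climbFree-noC w a p d none (<⇒≤ 3≤y)
  climbFree-tops (suc k) w a p d none 3≤y =
    notHigher⇒climbsInColumn 3≤y ∷ climbFree-tops k w a p (suc d) none ≤-refl

  climbFree-encode : ∀ {y} w q p → 2 ≤ row y → ClimbFree (y ∷ fill q p q (encode e₁ e₃ w))
  climbFree-encode []      q p 2≤y = climbFree-bottoms e₁ q p q (<⇒≤ 2≤y)
  climbFree-encode (𝐁 ∷ w) q p 2≤y = notHigher⇒climbsInColumn 2≤y ∷ climbFree-encode w q (suc p) ≤-refl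
  climbFree-encode (𝐂 ∷ w) q p 2≤y with countC w in noC
  ... | zero  = notHigher⇒climbsInColumn (<⇒≤ 2≤y) ∷ (λ _ → refl)
                ∷ climbFree-tops e₃ w (suc q) p (suc q) noC ≤-refl
  ... | suc _ = notHigher⇒climbsInColumn (<⇒≤ 2≤y) ∷ (λ _ → refl)
                ∷ climbFree-encode w (suc q) p (s≤s (s≤s z≤n))

-- Row words of climb-free fillings

bottom-start∈fill : ∀ a p d w {k} → count bottom w ≡ suc k → (1 , a) ∈ fill a p d w
bottom-start∈fill a p d (bottom ∷ w) _  = here refl
bottom-start∈fill a p d (middle ∷ w) eq = there (bottom-start∈fill a (suc p) d w eq)
bottom-start∈fill a p d (top ∷ w)    eq = there (bottom-start∈fill a p (suc d) w eq)

-- The next top cell (3 , d) could only be entered by a climb from (1 , d), which is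
-- either already placed or never will be.
no-top-after : ∀ x a p d w → ClimbFree (x ∷ fill a p d w) → col x ≢ d → row x < 3 →
               d < a ⊎ count bottom w ≡ 0 → p + count middle w ≤ d → count top w ≡ 0
no-top-after x a p d []           _                  _    _    _           _   = refl
no-top-after x a p d (top ∷ w)    (x↗ ∷ _)           x≢d  x<3  _           _   = ⊥-elim (x≢d (x↗ x<3))
no-top-after x a p d (bottom ∷ w) (_ ∷ climbFree)    _    _    (inj₁ d<a)  p≤d =
  no-top-after (1 , a) (suc a) p d w climbFree (λ a≡d → <-irrefl (sym a≡d) d<a) (s≤s z<s)
    (inj₁ (m≤n⇒m≤1+n d<a)) p≤d
no-top-after x a p d (middle ∷ w) (_ ∷ climbFree)    _    _    supported   p≤d =
  no-top-after (2 , p) a (suc p) d w climbFree (λ p≡d → <-irrefl p≡d (<-≤-trans (m<m+n p z<s) p≤d))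
    (s≤s (s≤s z<s)) supported (subst (_≤ d) (+-suc p _) p≤d)

only-bottoms : ∀ a p d w → ClimbFree ((1 , a) ∷ fill (suc a) p d w) → count top w ≡ 0 → p < a →
               ∃ λ k → w ≡ replicate k bottom
only-bottoms a p d []           _               _    _   = 0 , refl
only-bottoms a p d (bottom ∷ w) (_ ∷ climbFree) none p<a
  with only-bottoms (suc a) p d w climbFree none (m≤n⇒m≤1+n p<a)
... | k , refl = suc k , refl
only-bottoms a p d (middle ∷ w) (a↗ ∷ _)       _    p<a = ⊥-elim (<-irrefl (sym (a↗ (s≤s z<s))) p<a)

only-middles : ∀ w → count bottom w ≡ 0 → count top w ≡ 0 → ∃ λ k → w ≡ replicate k middle
only-middles []           _     _     = 0 , refl
only-middles (middle ∷ w) none₁ none₃ with only-middles w none₁ none₃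
... | k , refl = suc k , refl

tops-then-middles : ∀ x a p d w → ClimbFree ((3 , x) ∷ fill a p d w) → count bottom w ≡ 0 →
                    p + count middle w ≤ d → ∃ λ m → ∃ λ k → w ≡ replicate m top ++ replicate k middle
tops-then-middles x a p d []           _               _    _   = 0 , 0 , refl
tops-then-middles x a p d (top ∷ w)    (_ ∷ climbFree) none p≤d
  with tops-then-middles d a p (suc d) w climbFree none (m≤n⇒m≤1+n p≤d)
... | m , k , refl = suc m , k , refl
tops-then-middles x a p d (middle ∷ w) (_ ∷ climbFree) none p≤d
  with only-middles w none
         (no-top-after (2 , p) a (suc p) d w climbFree (λ p≡d → <-irrefl p≡d (<-≤-trans (m<m+n p z<s) p≤d))
           (s≤s (s≤s z<s)) (inj₂ none) (subst (_≤ d) (+-suc p _) p≤d))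
... | k , refl = 0 , suc k , refl

countC-decode-middles : ∀ k → countC (decode (replicate k middle)) ≡ 0
countC-decode-middles zero    = refl
countC-decode-middles (suc k) = countC-decode-middles k

encode-decode-middles : ∀ e₃ k → encode 0 e₃ (decode (replicate k middle)) ≡ replicate k middle
encode-decode-middles e₃ zero    = refl
encode-decode-middles e₃ (suc k) = cong (middle ∷_) (encode-decode-middles e₃ k)

reencode : List Row → List Row
reencode w = encode (count bottom w ∸ count top w) (count top w ∸ count bottom w) (decode w)

reencode-bottoms : ∀ k → reencode (replicate k bottom) ≡ replicate k bottom
reencode-bottoms k rewrite count-bottoms k | count-top-bottoms k | decode-bottoms k = refl

reencode-claw-end : ∀ m k → reencode (bottom ∷ top ∷ replicate m top ++ replicate k middle)
                            ≡ bottom ∷ top ∷ replicate m top ++ replicate k middle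
reencode-claw-end m k
  rewrite count-bottom-tops m (replicate k middle) | count-bottom-middles k
        | count-top-tops m (replicate k middle) | count-top-middles k | +-identityʳ m
        | decode-tops m (replicate k middle) | countC-decode-middles k | 0∸n≡0 m
        | encode-decode-middles m k = refl

reencode-no-surplus : ∀ w → reencode w ≡ w → whenZero (countC (decode w)) (count top w ∸ count bottom w) ≡ 0
reencode-no-surplus w fixed
  with countC (decode w) | count-top-encode (count bottom w ∸ count top w) (count top w ∸ count bottom w) (decode w)
... | suc _ | _ = refl
... | zero  | tops rewrite fixed | +-cancelʳ-≡ (count top w ∸ count bottom w) (count top w) 0 tops =
  0∸n≡0 (count bottom w)

reencode-climbFree : ∀ q p w → AllPairs Compatible (fill q p q w) → ClimbFree (fill q p q w) →
                     (count bottom w ≡ 0 → count top w ≡ 0) → p + count middle w ≤ q → reencode w ≡ w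
reencode-climbFree q p [] _ _ _ _ = refl
reencode-climbFree q p (middle ∷ w) (_ ∷ compatible) climbFree tops p≤q =
  cong (middle ∷_)
       (reencode-climbFree q (suc p) w compatible (Linked.tail climbFree) tops (subst (_≤ q) (+-suc p _) p≤q))
reencode-climbFree q p (top ∷ w) (q⊑w ∷ _) _ tops _ with count bottom w in bottoms
... | zero  = ⊥-elim (1+n≢0 (tops refl))
... | suc _ =
  ⊥-elim (<⇒≱ (proj₂ (All.lookup q⊑w (bottom-start∈fill q p (suc q) w bottoms)) refl) (s≤s z≤n))
reencode-climbFree q p (bottom ∷ []) _ _ _ _ = refl
reencode-climbFree q p (bottom ∷ middle ∷ w) _ (q↗p ∷ _) _ p≤q =
  ⊥-elim (<-irrefl (sym (q↗p (s≤s z<s))) (<-≤-trans (m<m+n p z<s) p≤q))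
reencode-climbFree q p (bottom ∷ bottom ∷ w) _ (_ ∷ climbFree) _ p≤q
  with only-bottoms (suc q) p q w climbFree
         (no-top-after (1 , suc q) (suc (suc q)) p q w climbFree 1+n≢n (s≤s z<s)
           (inj₁ (m≤n⇒m≤1+n ≤-refl)) p≤q)
         (s≤s (m+n≤o⇒m≤o p p≤q))
... | k , refl = reencode-bottoms (suc (suc k))
reencode-climbFree q p (bottom ∷ top ∷ w) (_ ∷ _ ∷ compatible) (_ ∷ climbFree) _ p≤q with count bottom w ≟ 0
... | yes none with tops-then-middles q (suc q) p (suc q) w climbFree none (m≤n⇒m≤1+n p≤q)
...   | m , k , refl = reencode-claw-end m k
reencode-climbFree q p (bottom ∷ top ∷ w) (_ ∷ _ ∷ compatible) (_ ∷ climbFree) _ p≤q | no some =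
  cong (λ v → bottom ∷ top ∷ v)
       (trans (cong (λ n → replicate n top ++ reencode w) (reencode-no-surplus w fixed)) fixed)
  where
  fixed : reencode w ≡ w
  fixed = reencode-climbFree (suc q) p w compatible (Linked.tail climbFree)
            (λ none → ⊥-elim (some none)) (m≤n⇒m≤1+n p≤q)

-- Rows and columns of skew diagrams

range : ℕ → ℕ → List ℕ
range s zero    = []
range s (suc n) = s ∷ range (suc s) n

applyUpTo≡range : ∀ (f : ℕ → ℕ) s n → (∀ i → f i ≡ s + i) → applyUpTo f n ≡ range s n
applyUpTo≡range f s zero    _   = refl
applyUpTo≡range f s (suc n) f≗ =
  cong₂ _∷_ (trans (f≗ 0) (+-identityʳ s))
            (applyUpTo≡range (λ i → f (suc i)) (suc s) n (λ i → trans (f≗ (suc i)) (+-suc s i)))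

filter-≤-range-all : ∀ k s m → k ≤ s → filter (k ≤?_) (range s m) ≡ range s m
filter-≤-range-all k s zero    _   = refl
filter-≤-range-all k s (suc m) k≤s =
  trans (filter-accept (k ≤?_) k≤s) (cong (s ∷_) (filter-≤-range-all k (suc s) m (m≤n⇒m≤1+n k≤s)))

filter-≤-range : ∀ k s t m → s + t ≡ k → filter (k ≤?_) (range s (t + m)) ≡ range k m
filter-≤-range k s zero    m s+0≡k =
  subst (λ k → filter (k ≤?_) (range s m) ≡ range k m) (trans (sym (+-identityʳ s)) s+0≡k)
        (filter-≤-range-all s s m ≤-refl)
filter-≤-range k s (suc t) m s+t≡k =
  trans (filter-reject (k ≤?_) (λ k≤s → <⇒≱ (subst (s <_) s+t≡k (m<m+n s z<s)) k≤s))
        (filter-≤-range k (suc s) t m (trans (sym (+-suc s t)) s+t≡k))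

map-range : ∀ r s m → map (λ j → (r , suc j)) (range s m) ≡ segment r (suc s) m
map-range r s zero    = refl
map-range r s (suc m) = cong ((r , suc s) ∷_) (map-range r (suc s) m)

rowCells≡segment : ∀ α β r → part β r ≤ part α r →
                   rowCells α β r ≡ segment (suc r) (suc (part β r)) (part α r ∸ part β r)
rowCells≡segment α β r β≤α = begin
  map (λ j → (suc r , suc j)) (filter (part β r ≤?_) (upTo (part α r)))
    ≡⟨ cong (λ xs → map (λ j → (suc r , suc j)) (filter (part β r ≤?_) xs))
            (trans (applyUpTo≡range (λ i → i) 0 (part α r) (λ _ → refl))
                   (cong (range 0) (sym (m+[n∸m]≡n β≤α)))) ⟩
  map (λ j → (suc r , suc j)) (filter (part β r ≤?_) (range 0 (part β r + (part α r ∸ part β r))))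
    ≡⟨ cong (map (λ j → (suc r , suc j))) (filter-≤-range (part β r) 0 (part β r) _ refl) ⟩
  map (λ j → (suc r , suc j)) (range (part β r) (part α r ∸ part β r))
    ≡⟨ map-range (suc r) (part β r) _ ⟩
  segment (suc r) (suc (part β r)) (part α r ∸ part β r) ∎
  where open ≡-Reasoning

whenZero-suc : ∀ {n} e → 1 ≤ n → whenZero n e ≡ 0
whenZero-suc e (s≤s _) = refl

range-++ : ∀ s m n → range s (m + n) ≡ range s m ++ range (s + m) n
range-++ s zero    n = cong (λ t → range t n) (sym (+-identityʳ s))
range-++ s (suc m) n =
  cong (s ∷_) (trans (range-++ (suc s) m n) (cong (λ t → range (suc s) m ++ range t n) (sym (+-suc s m))))

concatMap-range-cong : ∀ {A : Set} {f g : ℕ → List A} s n → (∀ j → s ≤ j → j < s + n → f j ≡ g j) →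
                       concatMap f (range s n) ≡ concatMap g (range s n)
concatMap-range-cong s zero    _   = refl
concatMap-range-cong s (suc n) f≗g =
  cong₂ _++_ (f≗g s ≤-refl (m<m+n s z<s))
             (concatMap-range-cong (suc s) n
                (λ j s<j j<s+n → f≗g j (<⇒≤ s<j) (subst (j <_) (sym (+-suc s n)) j<s+n)))

segment-columns : ∀ r s n → concatMap (λ j → [ (r , j) ]) (range s n) ≡ segment r s n
segment-columns r s zero    = refl
segment-columns r s (suc n) = cong ((r , s) ∷_) (segment-columns r (suc s) n)

inColumn : ∀ j (x : Cell) → Dec (col x ≡ j)
inColumn j x = col x ≟ j

column-segment-left : ∀ r s n j → j < s → filter (inColumn j) (segment r s n) ≡ []
column-segment-left r s zero    j _   = refl
column-segment-left r s (suc n) j j<s =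
  trans (filter-reject (inColumn j) (λ s≡j → <-irrefl (sym s≡j) j<s))
        (column-segment-left r (suc s) n j (m<n⇒m<1+n j<s))

column-segment-right : ∀ r s n j → s + n ≤ j → filter (inColumn j) (segment r s n) ≡ []
column-segment-right r s zero    j _     = refl
column-segment-right r s (suc n) j s+n≤j =
  trans (filter-reject (inColumn j) (λ s≡j → <-irrefl s≡j (<-≤-trans (m<m+n s z<s) s+n≤j)))
        (column-segment-right r (suc s) n j (subst (_≤ j) (+-suc s n) s+n≤j))

column-segment-inside : ∀ r s n j → s ≤ j → j < s + n → filter (inColumn j) (segment r s n) ≡ [ (r , j) ]
column-segment-inside r s zero    j s≤j j<s+0 = ⊥-elim (<⇒≱ j<s+0 (subst (_≤ j) (sym (+-identityʳ s)) s≤j))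
column-segment-inside r s (suc n) j s≤j j<s+n with m≤n⇒m<n∨m≡n s≤j
... | inj₂ refl =
  trans (filter-accept (inColumn s) refl) (cong ((r , s) ∷_) (column-segment-left r (suc s) n s ≤-refl))
... | inj₁ s<j  = trans (filter-reject (inColumn j) (λ s≡j → <-irrefl s≡j s<j))
                        (column-segment-inside r (suc s) n j s<j (subst (j <_) (+-suc s n) j<s+n))

clawColumn : ℕ → List Cell
clawColumn j = (1 , j) ∷ (3 , j) ∷ []

encode-𝐁s : ∀ e₁ e₃ k w → encode e₁ e₃ (replicate k 𝐁 ++ w) ≡ replicate k middle ++ encode e₁ e₃ w
encode-𝐁s e₁ e₃ zero    w = refl
encode-𝐁s e₁ e₃ (suc k) w = cong (middle ∷_) (encode-𝐁s e₁ e₃ k w)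

fill-middles : ∀ a p d k w → fill a p d (replicate k middle ++ w) ≡ segment 2 p k ++ fill a (k + p) d w
fill-middles a p d zero    w = refl
fill-middles a p d (suc k) w =
  cong ((2 , p) ∷_)
       (trans (fill-middles a (suc p) d k w) (cong (λ p′ → segment 2 (suc p) k ++ fill a p′ d w) (+-suc k p)))

fill-tops-bottoms : ∀ a p d m k →
                    fill a p d (replicate m top ++ replicate k bottom) ≡ segment 3 d m ++ segment 1 a k
fill-tops-bottoms a p d (suc m) k = cong ((3 , d) ∷_) (fill-tops-bottoms a p (suc d) m k)
fill-tops-bottoms a p d zero    zero    = refl
fill-tops-bottoms a p d zero    (suc k) = cong ((1 , a) ∷_) (fill-tops-bottoms (suc a) p d zero k)

fill-𝐂s : ∀ e₁ e₃ q p {n} → 1 ≤ n → fill q p q (encode e₁ e₃ (replicate n 𝐂))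
                          ≡ concatMap clawColumn (range q n) ++ segment 3 (q + n) e₃ ++ segment 1 (q + n) e₁
fill-𝐂s e₁ e₃ q p {suc zero}    _ =
  cong (λ cs → (1 , q) ∷ (3 , q) ∷ cs)
       (trans (fill-tops-bottoms (suc q) p (suc q) e₃ e₁)
              (cong (λ s → segment 3 s e₃ ++ segment 1 s e₁) (sym (+-comm q 1))))
fill-𝐂s e₁ e₃ q p {suc (suc n)} _ =
  cong (λ cs → (1 , q) ∷ (3 , q) ∷ cs)
       (trans (fill-𝐂s e₁ e₃ (suc q) p {suc n} (s≤s z≤n))
              (cong (λ s → concatMap clawColumn (range (suc q) (suc n)) ++ segment 3 s e₃ ++ segment 1 s e₁)
                    (sym (+-suc q (suc n)))))

-- Enumerating words

words : ℕ → ℕ → List (List Letter)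
words zero    zero    = [ [] ]
words zero    (suc c) = map (𝐂 ∷_) (words zero c)
words (suc b) zero    = map (𝐁 ∷_) (words b zero)
words (suc b) (suc c) = map (𝐁 ∷_) (words b (suc c)) ++ map (𝐂 ∷_) (words (suc b) c)

∈-words⇒isWord : ∀ b c {w} → w ∈ words b c → IsWord b c w
∈-words⇒isWord zero zero (here refl) = refl , refl
∈-words⇒isWord zero (suc c) w∈ with ∈-map⁻ _ w∈
... | v , v∈ , refl = map₂ (cong suc) (∈-words⇒isWord zero c v∈)
∈-words⇒isWord (suc b) zero w∈ with ∈-map⁻ _ w∈
... | v , v∈ , refl = map₁ (cong suc) (∈-words⇒isWord b zero v∈)
∈-words⇒isWord (suc b) (suc c) w∈ with ∈-++⁻ (map (𝐁 ∷_) (words b (suc c))) w∈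
... | inj₁ w∈B with ∈-map⁻ _ w∈B
...   | v , v∈ , refl = map₁ (cong suc) (∈-words⇒isWord b (suc c) v∈)
∈-words⇒isWord (suc b) (suc c) w∈ | inj₂ w∈C with ∈-map⁻ _ w∈C
...   | v , v∈ , refl = map₂ (cong suc) (∈-words⇒isWord (suc b) c v∈)

∈-words : ∀ w → w ∈ words (countB w) (countC w)
∈-words []      = here refl
∈-words (𝐁 ∷ w) with countC w | ∈-words w
... | zero  | w∈ = ∈-map⁺ (𝐁 ∷_) w∈
... | suc _ | w∈ = ∈-++⁺ˡ (∈-map⁺ (𝐁 ∷_) w∈)
∈-words (𝐂 ∷ w) with countB w | ∈-words w
... | zero  | w∈ = ∈-map⁺ (𝐂 ∷_) w∈
... | suc b | w∈ = ∈-++⁺ʳ (map (𝐁 ∷_) (words b (suc (countC w)))) (∈-map⁺ (𝐂 ∷_) w∈)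

isWord⇒∈-words : ∀ {b c w} → IsWord b c w → w ∈ words b c
isWord⇒∈-words {w = w} (refl , refl) = ∈-words w

words-unique : ∀ b c → Unique (words b c)
words-unique zero    zero    = [] ∷ []
words-unique zero    (suc c) = Unique.map⁺ ∷-injectiveʳ (words-unique zero c)
words-unique (suc b) zero    = Unique.map⁺ ∷-injectiveʳ (words-unique b zero)
words-unique (suc b) (suc c) =
  Unique.++⁺ (Unique.map⁺ ∷-injectiveʳ (words-unique b (suc c)))
             (Unique.map⁺ ∷-injectiveʳ (words-unique (suc b) c)) B≢C
  where
  B≢C : ∀ {v} → ¬ (v ∈ map (𝐁 ∷_) (words b (suc c)) × v ∈ map (𝐂 ∷_) (words (suc b) c))
  B≢C (v∈B , v∈C) with ∈-map⁻ _ v∈B | ∈-map⁻ _ v∈C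
  ... | _ , _ , refl | _ , _ , ()

length-words : ∀ b c → length (words b c) ≡ (b + c) C b
length-words zero    zero    = refl
length-words zero    (suc c) = trans (length-map (𝐂 ∷_) (words zero c)) (length-words zero c)
length-words (suc b) zero    = begin
  length (map (𝐁 ∷_) (words b zero)) ≡⟨ length-map (𝐁 ∷_) (words b zero) ⟩
  length (words b zero)               ≡⟨ length-words b zero ⟩
  (b + 0) C b                         ≡⟨ cong (_C b) (+-identityʳ b) ⟩
  b C b                               ≡⟨ nCn≡1 b ⟩
  1                                   ≡⟨ sym (nCn≡1 (suc b)) ⟩
  suc b C suc b                       ≡⟨ cong (_C suc b) (sym (+-identityʳ (suc b))) ⟩
  (suc b + 0) C suc b                 ∎
  where open ≡-Reasoning
length-words (suc b) (suc c) = begin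
  length (map (𝐁 ∷_) (words b (suc c)) ++ map (𝐂 ∷_) (words (suc b) c))
    ≡⟨ length-++ (map (𝐁 ∷_) (words b (suc c))) ⟩
  length (map (𝐁 ∷_) (words b (suc c))) + length (map (𝐂 ∷_) (words (suc b) c))
    ≡⟨ cong₂ _+_ (trans (length-map (𝐁 ∷_) (words b (suc c))) (length-words b (suc c)))
                 (trans (length-map (𝐂 ∷_) (words (suc b) c)) (length-words (suc b) c)) ⟩
  (b + suc c) C b + suc (b + c) C suc b
    ≡⟨ cong (λ n → (b + suc c) C b + n C suc b) (sym (+-suc b c)) ⟩
  (b + suc c) C b + (b + suc c) C suc b
    ≡⟨ nCk+nC[k+1]≡[n+1]C[k+1] (b + suc c) b ⟩
  suc (b + suc c) C suc b ∎
  where open ≡-Reasoning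

isWord-𝐁s𝐂s : ∀ b c → IsWord b c (replicate b 𝐁 ++ replicate c 𝐂)
isWord-𝐁s𝐂s (suc b) c    = map₁ (cong suc) (isWord-𝐁s𝐂s b c)
isWord-𝐁s𝐂s zero zero    = refl , refl
isWord-𝐁s𝐂s zero (suc c) = map₂ (cong suc) (isWord-𝐁s𝐂s zero c)

-- The right lobster

module Lobster (b c₁ c₂ : ℕ) where

  α : Composition
  α = lobsterα b c₁ c₂

  β : Composition
  β = lobsterβ b

  claw : ℕ
  claw = 2 + b

  c e₁ e₃ : ℕ
  c  = c₁ ⊓ c₂
  e₁ = c₂ ∸ c₁
  e₃ = c₁ ∸ c₂

  c+e₁≡c₂ : c + e₁ ≡ c₂
  c+e₁≡c₂ = m⊓n+n∸m≡n c₁ c₂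

  c+e₃≡c₁ : c + e₃ ≡ c₁
  c+e₃≡c₁ = trans (cong (_+ e₃) (⊓-comm c₁ c₂)) (m⊓n+n∸m≡n c₂ c₁)

  e₁≡0⊎e₃≡0 : e₁ ≡ 0 ⊎ e₃ ≡ 0
  e₁≡0⊎e₃≡0 = [ inj₂ ∘ m≤n⇒m∸n≡0 , inj₁ ∘ m≤n⇒m∸n≡0 ]′ (≤-total c₁ c₂)

  lobster-cells : cells α β ≡ threeRows claw 2 claw c₂ b c₁
  lobster-cells = cong₂ _++_ bottom-claw (cong₂ _++_ body (trans (++-identityʳ _) top-claw))
    where
    claw-start : suc (b + 1) ≡ claw
    claw-start = cong suc (+-comm b 1)
    bottom-claw : rowCells α β 0 ≡ segment 1 claw c₂
    bottom-claw = trans (rowCells≡segment α β 0 (m≤m+n (b + 1) c₂))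
                        (cong₂ (segment 1) claw-start (m+n∸m≡n (b + 1) c₂))
    body : rowCells α β 1 ≡ segment 2 2 b
    body = trans (rowCells≡segment α β 1 (m≤n+m 1 b)) (cong (segment 2 2) (m+n∸n≡m b 1))
    top-claw : rowCells α β 2 ≡ segment 3 claw c₁
    top-claw = trans (rowCells≡segment α β 2 (m≤m+n (b + 1) c₁))
                     (cong₂ (segment 3) claw-start (m+n∸m≡n (b + 1) c₁))

  minimalFilling : List Letter → Filling
  minimalFilling w = fill claw 2 claw (encode e₁ e₃ w)

  minimalFilling-minimal : 1 ≤ c → ∀ w → IsWord b c w → IsMinimal α β (minimalFilling w)
  minimalFilling-minimal 1≤c w (#B , #C) = climbFree⇒minimal {α} {β} (permutation , compatible) climbFree
    where
    E = encode e₁ e₃ w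
    #bottom : count bottom E ≡ c₂
    #bottom = trans (count-bottom-encode e₁ e₃ w) (trans (cong (_+ e₁) #C) c+e₁≡c₂)
    #middle : count middle E ≡ b
    #middle = trans (count-middle-encode e₁ e₃ w) #B
    #top : count top E ≡ c₁
    #top = begin
      count top E                             ≡⟨ sym (+-identityʳ _) ⟩
      count top E + 0
        ≡⟨ cong (count top E +_) (sym (whenZero-suc e₃ (subst (1 ≤_) (sym #C) 1≤c))) ⟩
      count top E + whenZero (countC w) e₃    ≡⟨ count-top-encode e₁ e₃ w ⟩
      countC w + e₃                           ≡⟨ cong (_+ e₃) #C ⟩
      c + e₃                                  ≡⟨ c+e₃≡c₁ ⟩
      c₁                                      ∎
      where open ≡-Reasoning
    permutation : minimalFilling w ↭ cells α β
    permutation = ↭-trans (fill↭threeRows claw 2 claw E)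
      (↭-reflexive (trans (cong₂ (λ n₁ n₂ → threeRows claw 2 claw n₁ n₂ (count top E)) #bottom #middle)
                          (trans (cong (threeRows claw 2 claw c₂ b) #top) (sym lobster-cells))))
    middle≤claw : 2 + count middle E ≤ claw
    middle≤claw = subst (λ n → 2 + n ≤ claw) (sym #middle) ≤-refl
    compatible : AllPairs Compatible (minimalFilling w)
    compatible =
      fill-compatible claw 2 claw E middle≤claw middle≤claw (encode-topsSupported e₁ e₃ e₁≡0⊎e₃≡0 w claw)
    climbFree : ClimbFree (minimalFilling w)
    climbFree = Linked.tail (climbFree-encode e₁ e₃ {y = (2 , 0)} w claw 2 ≤-refl)

  minimalFilling-injective : ∀ {w w′} → minimalFilling w ≡ minimalFilling w′ → w ≡ w′
  minimalFilling-injective {w} {w′} eq =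
    trans (sym (decode-encode e₁ e₃ w)) (trans (cong decode (fill-injective claw 2 claw eq)) (decode-encode e₁ e₃ w′))

  minimal⇒minimalFilling : 1 ≤ c → ∀ T → IsMinimal α β T → ∃ λ w → IsWord b c w × minimalFilling w ≡ T
  minimal⇒minimalFilling 1≤c T T-min with isSET⇒standard (proj₁ T-min)
  ... | T↭ , compatible with threeRows⇒fill claw 2 claw c₂ b c₁ (↭-trans T↭ (↭-reflexive lobster-cells)) compatible
  ... | rw , refl , #bottom , #middle , #top = decode rw , (#B , #C) , cong (fill claw 2 claw) encoded
    where
    fixed : reencode rw ≡ rw
    fixed = reencode-climbFree claw 2 rw compatible (minimal⇒climbFree {α} {β} T-min)
              (λ none → ⊥-elim (<⇒≢ (≤-trans 1≤c (m⊓n≤n c₁ c₂)) (trans (sym none) #bottom)))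
              (subst (λ n → 2 + n ≤ claw) (sym #middle) ≤-refl)
    encoded : encode e₁ e₃ (decode rw) ≡ rw
    encoded = trans (cong₂ (λ n₁ n₃ → encode (n₁ ∸ n₃) (n₃ ∸ n₁) (decode rw)) (sym #bottom) (sym #top)) fixed
    #B : countB (decode rw) ≡ b
    #B = trans (sym (count-middle-encode e₁ e₃ (decode rw))) (trans (cong (count middle) encoded) #middle)
    #C : countC (decode rw) ≡ c
    #C = +-cancelʳ-≡ e₁ _ _ (trans (sym (count-bottom-encode e₁ e₃ (decode rw)))
                              (trans (cong (count bottom) encoded) (trans #bottom (sym c+e₁≡c₂))))

  ∈-minimalFillings⇔minimal : 1 ≤ c → ∀ T → (T ∈ map minimalFilling (words b c)) ⇔ IsMinimal α β T
  ∈-minimalFillings⇔minimal 1≤c T = mk⇔ to from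
    where
    to : T ∈ map minimalFilling (words b c) → IsMinimal α β T
    to T∈ with ∈-map⁻ minimalFilling T∈
    ... | w , w∈ , refl = minimalFilling-minimal 1≤c w (∈-words⇒isWord b c w∈)
    from : IsMinimal α β T → T ∈ map minimalFilling (words b c)
    from T-min with minimal⇒minimalFilling 1≤c T T-min
    ... | w , w-word , refl = ∈-map⁺ minimalFilling (isWord⇒∈-words {w = w} w-word)

  column : ℕ → List Cell
  column j = filter (inColumn j) (threeRows claw 2 claw c₂ b c₁)

  column-rows : ∀ j → column j ≡ filter (inColumn j) (segment 1 claw c₂) ++ filter (inColumn j) (segment 2 2 b)
                                  ++ filter (inColumn j) (segment 3 claw c₁)
  column-rows j = trans (filter-++ (inColumn j) (segment 1 claw c₂) _)
                        (cong (filter (inColumn j) (segment 1 claw c₂) ++_) (filter-++ (inColumn j) (segment 2 2 b) _))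

  columns-in-row : ∀ r s n → (∀ j → s ≤ j → j < s + n → column j ≡ [ (r , j) ]) →
                   concatMap column (range s n) ≡ segment r s n
  columns-in-row r s n single = trans (concatMap-range-cong s n single) (segment-columns r s n)

  first-column : column 1 ≡ []
  first-column
    rewrite column-rows 1 | column-segment-left 1 claw c₂ 1 (s≤s (s≤s z≤n)) | column-segment-left 2 2 b 1 ≤-refl
          | column-segment-left 3 claw c₁ 1 (s≤s (s≤s z≤n)) = refl

  body-columns : concatMap column (range 2 b) ≡ segment 2 2 b
  body-columns = columns-in-row 2 2 b body-column
    where
    body-column : ∀ j → 2 ≤ j → j < claw → column j ≡ [ (2 , j) ]
    body-column j 2≤j j<claw
      rewrite column-rows j | column-segment-left 1 claw c₂ j j<claw | column-segment-inside 2 2 b j 2≤j j<claw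
            | column-segment-left 3 claw c₁ j j<claw = refl

  claw-columns : concatMap column (range claw c) ≡ concatMap clawColumn (range claw c)
  claw-columns = concatMap-range-cong claw c claw-column
    where
    claw-column : ∀ j → claw ≤ j → j < claw + c → column j ≡ clawColumn j
    claw-column j claw≤j j<claw+c
      rewrite column-rows j
            | column-segment-inside 1 claw c₂ j claw≤j (<-≤-trans j<claw+c (+-monoʳ-≤ claw (m⊓n≤n c₁ c₂)))
            | column-segment-right 2 2 b j claw≤j
            | column-segment-inside 3 claw c₁ j claw≤j (<-≤-trans j<claw+c (+-monoʳ-≤ claw (m⊓n≤m c₁ c₂))) = refl

  tail-columns : concatMap column (range (claw + c) (e₁ + e₃)) ≡ segment 3 (claw + c) e₃ ++ segment 1 (claw + c) e₁
  tail-columns with ≤-total c₁ c₂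
  ... | inj₁ c₁≤c₂ =
    subst (λ e → concatMap column (range (claw + c) (e₁ + e)) ≡ segment 3 (claw + c) e ++ segment 1 (claw + c) e₁)
          (sym (m≤n⇒m∸n≡0 c₁≤c₂))
          (trans (cong (λ n → concatMap column (range (claw + c) n)) (+-identityʳ e₁))
                 (columns-in-row 1 (claw + c) e₁ bottom-column))
    where
    bottom-column : ∀ j → claw + c ≤ j → j < claw + c + e₁ → column j ≡ [ (1 , j) ]
    bottom-column j claw+c≤j j<end
      rewrite column-rows j
            | column-segment-inside 1 claw c₂ j (≤-trans (m≤m+n claw c) claw+c≤j)
                (subst (j <_) (trans (+-assoc claw c e₁) (cong (claw +_) c+e₁≡c₂)) j<end)
            | column-segment-right 2 2 b j (≤-trans (m≤m+n claw c) claw+c≤j)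
            | column-segment-right 3 claw c₁ j (subst (λ n → claw + n ≤ j) (m≤n⇒m⊓n≡m c₁≤c₂) claw+c≤j) = refl
  ... | inj₂ c₂≤c₁ =
    subst (λ e → concatMap column (range (claw + c) (e + e₃)) ≡ segment 3 (claw + c) e₃ ++ segment 1 (claw + c) e)
          (sym (m≤n⇒m∸n≡0 c₂≤c₁))
          (trans (columns-in-row 3 (claw + c) e₃ top-column) (sym (++-identityʳ _)))
    where
    top-column : ∀ j → claw + c ≤ j → j < claw + c + e₃ → column j ≡ [ (3 , j) ]
    top-column j claw+c≤j j<end
      rewrite column-rows j
            | column-segment-right 1 claw c₂ j (subst (λ n → claw + n ≤ j) (m≥n⇒m⊓n≡n c₂≤c₁) claw+c≤j)
            | column-segment-right 2 2 b j (≤-trans (m≤m+n claw c) claw+c≤j)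
            | column-segment-inside 3 claw c₁ j (≤-trans (m≤m+n claw c) claw+c≤j)
                (subst (j <_) (trans (+-assoc claw c e₃) (cong (claw +_) c+e₃≡c₁)) j<end) = refl

  c₂⊔c₁≡c+[e₁+e₃] : c₂ ⊔ c₁ ≡ c + (e₁ + e₃)
  c₂⊔c₁≡c+[e₁+e₃] with ≤-total c₁ c₂
  ... | inj₁ c₁≤c₂ = begin
    c₂ ⊔ c₁         ≡⟨ m≥n⇒m⊔n≡m c₁≤c₂ ⟩
    c₂              ≡⟨ sym c+e₁≡c₂ ⟩
    c + e₁          ≡⟨ cong (c +_) (sym (+-identityʳ e₁)) ⟩
    c + (e₁ + 0)    ≡⟨ cong (λ e → c + (e₁ + e)) (sym (m≤n⇒m∸n≡0 c₁≤c₂)) ⟩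
    c + (e₁ + e₃)   ∎
    where open ≡-Reasoning
  ... | inj₂ c₂≤c₁ = begin
    c₂ ⊔ c₁         ≡⟨ m≤n⇒m⊔n≡n c₂≤c₁ ⟩
    c₁              ≡⟨ sym c+e₃≡c₁ ⟩
    c + e₃          ≡⟨ cong (λ e → c + (e + e₃)) (sym (m≤n⇒m∸n≡0 c₂≤c₁)) ⟩
    c + (e₁ + e₃)   ∎
    where open ≡-Reasoning

  width : foldr _⊔_ 0 α ≡ suc (b + (c + (e₁ + e₃)))
  width = begin
    (b + 1 + c₂) ⊔ ((b + 1) ⊔ ((b + 1 + c₁) ⊔ 0))
      ≡⟨ cong (λ n → (b + 1 + c₂) ⊔ ((b + 1) ⊔ n)) (⊔-identityʳ _) ⟩
    (b + 1 + c₂) ⊔ ((b + 1) ⊔ (b + 1 + c₁))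
      ≡⟨ cong ((b + 1 + c₂) ⊔_) (m≤n⇒m⊔n≡n (m≤m+n (b + 1) c₁)) ⟩
    (b + 1 + c₂) ⊔ (b + 1 + c₁)                   ≡⟨ sym (+-distribˡ-⊔ (b + 1) c₂ c₁) ⟩
    b + 1 + (c₂ ⊔ c₁)                             ≡⟨ cong (b + 1 +_) c₂⊔c₁≡c+[e₁+e₃] ⟩
    b + 1 + (c + (e₁ + e₃))                       ≡⟨ +-assoc b 1 _ ⟩
    b + suc (c + (e₁ + e₃))                       ≡⟨ +-suc b _ ⟩
    suc (b + (c + (e₁ + e₃)))                     ∎
    where open ≡-Reasoning

  Scol-columns : Scol α β ≡ concatMap column (range 1 (suc (b + (c + (e₁ + e₃)))))
  Scol-columns =
    trans (concatMap-cong (λ j → cong (filter (inColumn j)) lobster-cells) (map suc (upTo (foldr _⊔_ 0 α))))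
          (cong (concatMap column)
                (trans (map-applyUpTo (λ i → i) suc _)
                       (trans (applyUpTo≡range suc 1 _ (λ _ → refl)) (cong (range 1) width))))

  Scol≡segments : Scol α β ≡ segment 2 2 b ++ concatMap clawColumn (range claw c)
                             ++ segment 3 (claw + c) e₃ ++ segment 1 (claw + c) e₁
  Scol≡segments = begin
    Scol α β
      ≡⟨ Scol-columns ⟩
    column 1 ++ concatMap column (range 2 (b + (c + (e₁ + e₃))))
      ≡⟨ cong₂ _++_ first-column (cong (concatMap column) (range-++ 2 b _)) ⟩
    concatMap column (range 2 b ++ range claw (c + (e₁ + e₃)))
      ≡⟨ concatMap-++ column (range 2 b) _ ⟩
    concatMap column (range 2 b) ++ concatMap column (range claw (c + (e₁ + e₃)))
      ≡⟨ cong₂ _++_ body-columns (trans (cong (concatMap column) (range-++ claw c _))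
                                        (concatMap-++ column (range claw c) _)) ⟩
    segment 2 2 b ++ concatMap column (range claw c) ++ concatMap column (range (claw + c) (e₁ + e₃))
      ≡⟨ cong (segment 2 2 b ++_) (cong₂ _++_ claw-columns tail-columns) ⟩
    segment 2 2 b ++ concatMap clawColumn (range claw c) ++ segment 3 (claw + c) e₃ ++ segment 1 (claw + c) e₁ ∎
    where open ≡-Reasoning

  Scol≡minimalFilling : 1 ≤ c → Scol α β ≡ minimalFilling (replicate b 𝐁 ++ replicate c 𝐂)
  Scol≡minimalFilling 1≤c = begin
    Scol α β
      ≡⟨ Scol≡segments ⟩
    segment 2 2 b ++ concatMap clawColumn (range claw c) ++ segment 3 (claw + c) e₃ ++ segment 1 (claw + c) e₁
      ≡⟨ cong (segment 2 2 b ++_) (sym (fill-𝐂s e₁ e₃ claw (b + 2) 1≤c)) ⟩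
    segment 2 2 b ++ fill claw (b + 2) claw (encode e₁ e₃ (replicate c 𝐂))
      ≡⟨ sym (fill-middles claw 2 claw b _) ⟩
    fill claw 2 claw (replicate b middle ++ encode e₁ e₃ (replicate c 𝐂))
      ≡⟨ cong (fill claw 2 claw) (sym (encode-𝐁s e₁ e₃ b _)) ⟩
    minimalFilling (replicate b 𝐁 ++ replicate c 𝐂) ∎
    where open ≡-Reasoning

theorem20 : (b c₁ c₂ : ℕ) → 1 ≤ b → 1 ≤ c₁ → 1 ≤ c₂ →
    (Σ (List Letter → Filling) λ f →
        (∀ w → IsWord b (c₁ ⊓ c₂) w → IsMinimal (lobsterα b c₁ c₂) (lobsterβ b) (f w))
      × (∀ w w′ → IsWord b (c₁ ⊓ c₂) w → IsWord b (c₁ ⊓ c₂) w′ → f w ≡ f w′ → w ≡ w′)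
      × (∀ T → IsMinimal (lobsterα b c₁ c₂) (lobsterβ b) T →
           ∃ λ w → IsWord b (c₁ ⊓ c₂) w × f w ≡ T))
    × (Σ (List Filling) λ L → Unique L
        × (∀ T → (T ∈ L) ⇔ IsMinimal (lobsterα b c₁ c₂) (lobsterβ b) T)
        × length L ≡ (b + (c₁ ⊓ c₂)) C b)
    × IsMinimal (lobsterα b c₁ c₂) (lobsterβ b) (Scol (lobsterα b c₁ c₂) (lobsterβ b))
-- The argument also covers an empty body.
theorem20 b c₁ c₂ _ 1≤c₁ 1≤c₂ =
    ( minimalFilling , minimalFilling-minimal 1≤c , (λ _ _ _ _ → minimalFilling-injective)
    , minimal⇒minimalFilling 1≤c )
  , (map minimalFilling (words b c)
    , Unique.map⁺ minimalFilling-injective (words-unique b c)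
    , ∈-minimalFillings⇔minimal 1≤c
    , trans (length-map minimalFilling (words b c)) (length-words b c))
  , subst (IsMinimal α β) (sym (Scol≡minimalFilling 1≤c))
          (minimalFilling-minimal 1≤c (replicate b 𝐁 ++ replicate c 𝐂) (isWord-𝐁s𝐂s b c))
  where
  open Lobster b c₁ c₂
  1≤c : 1 ≤ c
  1≤c = ⊓-glb 1≤c₁ 1≤c₂
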